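{- Let $n\geq 3$ and let $A$ be a vertex of the cycle $C_n$. Then the sages win the hat guessing game on $C_n$ with the hint $A-1$.
   Context: Hat guessing game: a sage sits at each vertex of a finite graph; hat colors are $H=\{0,1,2\}$; each sage sees only his neighbours' hats and guesses his own color by a deterministic function of the neighbours' colors, fixed in advance. Hint $A-1$: sage $A$ gets a hat of one of two colors, and these two colors are explicitly known to everyone in advance; i.e. a color $i\in H$ is announced in advance and only placements $C$ with $C(A)\ne i$ occur. The sages win with the hint $A-1$ if for every announced color $i\in H$ there is a strategy such that every hat placement $C$ with $C(A)\neq i$ has at least one correct guess (by permuting the color names, this is equivalent to the existence of such a strategy for a single $i$). -}

module Defs where

open import Data.Nat using (ℕ; suc)
open import Data.Fin using (Fin; toℕ)
open import Data.Nat.DivMod using (_%_)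
open import Data.Product using (Σ; ∃; _,_; proj₁)
open import Relation.Binary.PropositionalEquality using (_≡_; _≢_)
open import Data.Sum using (_⊎_)

record Graph (n : ℕ) : Set₁ where
  field
    Adj : Fin n → Fin n → Set

open Graph public

Colour : Set
Colour = Fin 3

Placement : ℕ → Set
Placement n = Fin n → Colour

Nbr : ∀ {n} → Graph n → Fin n → Set
Nbr G v = Σ (Fin _) (λ w → Adj G v w)

Strategy : ∀ {n} → Graph n → Set
Strategy G = ∀ v → (Nbr G v → Colour) → Colour

view : ∀ {n} (G : Graph n) → Placement n → (v : Fin n) → Nbr G v → Colour
view G C v w = C (proj₁ w)

SomeoneCorrect : ∀ {n} (G : Graph n) → Strategy G → Placement n → Set
SomeoneCorrect G f C = ∃ λ v → f v (view G C v) ≡ C v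

-- Sages win on G with hint A-1: for every announced colour i there is a
-- strategy such that every placement C with C(A) ≠ i has a correct guess.
WinsWithHintA-1 : ∀ {n} → Graph n → Fin n → Set
WinsWithHintA-1 {n} G A =
  (i : Colour) → Σ (Strategy G) λ f → (C : Placement n) → C A ≢ i → SomeoneCorrect G f C

Cycle : (n : ℕ) → Graph (suc n)
Cycle n = record
  { Adj = λ u v → (toℕ v ≡ suc (toℕ u) % suc n) ⊎ (toℕ u ≡ suc (toℕ v) % suc n) }

-- Read the cycle from A as w₀ = A, w₁, …, wₙ and let a, b be the two colours A
-- may wear. A guesses a if w₁ wears 2 or wₙ wears 0, and b otherwise; seeing b
-- on A, w₁ guesses 2 and wₙ guesses 0, so if A wears b and is wrong, one of them
-- is right. If A wears a and is wrong, then w₁ ∈ {0,1} and wₙ ∈ {1,2}. The sages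
-- w₁, …, wₙ₋₁ guess so that a wrong guess at wₖ forces C(wₖ) = bit C(wₖ₊₁),
-- where bit 2 = 1 and bit 0 = bit 1 = 0; then wₙ, guessing C(wₙ₋₁) + 1 mod 3, is right.
module Submission where

open import Defs
open import Data.Nat using (ℕ; suc; _≤_)
open import Data.Fin using (Fin)

open import Data.Bool using (if_then_else_)
open import Data.Fin using (zero; suc; toℕ; _≟_)
open import Data.Fin.Properties using (toℕ-fromℕ<; toℕ-injective; toℕ<n; any?)
open import Data.Nat using (zero; _+_; _*_; _<_; s≤s; z≤n; NonZero)
open import Data.Nat.DivMod using (_%_; _/_; _mod_; m≡m%n+[m/n]*n; [m+kn]%n≡m%n; [m+n]%n≡m%n; m<n⇒m%n≡m)
open import Data.Nat.Divisibility using (divides; >⇒∤)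
open import Data.Nat.GeneralisedArithmetic using (fold; iterate; iterate-is-fold)
open import Data.Nat.Properties using (+-identityʳ; +-suc; +-cancelˡ-≡; ≤-refl; m<n⇒m<1+n; <⇒≤)
open import Data.Product using (_,_)
open import Data.Sum using (_⊎_; inj₁; inj₂; [_,_])
open import Relation.Nullary using (Dec; ¬_; does; contradiction)
open import Relation.Nullary.Decidable using (dec-true; dec-false; decidable-stable; _⊎-dec_)
open import Relation.Binary.PropositionalEquality hiding ([_])

pattern c₀ = zero
pattern c₁ = suc zero
pattern c₂ = suc (suc zero)

rotate : Colour → Colour
rotate c₀ = c₁
rotate c₁ = c₂
rotate c₂ = c₀

≢⇒rotate⊎rotate² : ∀ {i x} → x ≢ i → x ≡ rotate i ⊎ x ≡ rotate (rotate i)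
≢⇒rotate⊎rotate² {c₀} {c₀} x≢i = contradiction refl x≢i
≢⇒rotate⊎rotate² {c₀} {c₁} _   = inj₁ refl
≢⇒rotate⊎rotate² {c₀} {c₂} _   = inj₂ refl
≢⇒rotate⊎rotate² {c₁} {c₀} _   = inj₂ refl
≢⇒rotate⊎rotate² {c₁} {c₁} x≢i = contradiction refl x≢i
≢⇒rotate⊎rotate² {c₁} {c₂} _   = inj₁ refl
≢⇒rotate⊎rotate² {c₂} {c₀} _   = inj₁ refl
≢⇒rotate⊎rotate² {c₂} {c₁} _   = inj₂ refl
≢⇒rotate⊎rotate² {c₂} {c₂} x≢i = contradiction refl x≢i

bit : Colour → Colour
bit c₂ = c₁
bit _  = c₀

cobit : Colour → Colour
cobit c₂ = c₀
cobit _  = c₁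

cobit-miss : ∀ {x} r → x ≢ c₂ → cobit r ≢ x → x ≡ bit r
cobit-miss {c₀} c₀ _ _   = refl
cobit-miss {c₀} c₁ _ _   = refl
cobit-miss {c₀} c₂ _ ne  = contradiction refl ne
cobit-miss {c₁} c₀ _ ne  = contradiction refl ne
cobit-miss {c₁} c₁ _ ne  = contradiction refl ne
cobit-miss {c₁} c₂ _ _   = refl
cobit-miss {c₂} _  ne _  = contradiction refl ne

innerGuess : Colour → Colour → Colour
innerGuess c₁ _ = c₂
innerGuess _  r = cobit r

innerGuess-miss : ∀ x r → innerGuess (bit x) r ≢ x → x ≡ bit r
innerGuess-miss c₀ r ne = cobit-miss r (λ ()) ne
innerGuess-miss c₁ r ne = cobit-miss r (λ ()) ne
innerGuess-miss c₂ r ne = contradiction refl ne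

rotate-bit : ∀ {x} → x ≢ c₀ → rotate (bit x) ≡ x
rotate-bit {c₀} ne = contradiction refl ne
rotate-bit {c₁} _  = refl
rotate-bit {c₂} _  = refl

if-yes : ∀ {P X : Set} (p? : Dec P) {x y : X} → P → (if does p? then x else y) ≡ x
if-yes p? p rewrite dec-true p? p = refl

if-no : ∀ {P X : Set} (p? : Dec P) {x y : X} → ¬ P → (if does p? then x else y) ≡ y
if-no p? ¬p rewrite dec-false p? ¬p = refl

Hit : Colour → Colour → Set
Hit l r = r ≡ c₂ ⊎ l ≡ c₀

hit? : ∀ l r → Dec (Hit l r)
hit? l r = r ≟ c₂ ⊎-dec l ≟ c₀

data Role : Set where
  apex first last inner : Role

module CycleStrategy
  {m : ℕ} (G : Graph m) (next : Fin m → Fin m) (d : ℕ)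
  (next-adj : ∀ v → Adj G v (next v)) (next-adj⁻ : ∀ v → Adj G (next v) v)
  (period : ∀ v → fold v next (3 + d) ≡ v)
  where

  prev : Fin m → Fin m
  prev v = fold v next (2 + d)

  prev-next : ∀ v → prev (next v) ≡ v
  prev-next v = begin
    fold (next v) next (2 + d)     ≡⟨ iterate-is-fold (next v) next (2 + d) ⟩
    iterate next (next v) (2 + d)  ≡⟨ iterate-is-fold v next (3 + d) ⟨
    fold v next (3 + d)            ≡⟨ period v ⟩
    v                              ∎
    where open ≡-Reasoning

  right left : ∀ v → Nbr G v
  right v = next v , next-adj v
  left  v = prev v , subst (λ u → Adj G u (prev v)) (period v) (next-adj⁻ (prev v))

  module _ (A : Fin m) (a b : Colour) where

    role : Fin m → Role
    role v = if does (v ≟ A) then apex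
             else if does (v ≟ next A) then first
             else if does (next v ≟ A) then last
             else inner

    role-apex : role A ≡ apex
    role-apex rewrite dec-true (A ≟ A) refl = refl

    role-first : ∀ {v} → v ≢ A → v ≡ next A → role v ≡ first
    role-first {v} v≢A e rewrite dec-false (v ≟ A) v≢A | dec-true (v ≟ next A) e = refl

    role-last : ∀ {v} → v ≢ A → v ≢ next A → next v ≡ A → role v ≡ last
    role-last {v} v≢A v≢A⁺ e
      rewrite dec-false (v ≟ A) v≢A | dec-false (v ≟ next A) v≢A⁺ | dec-true (next v ≟ A) e = refl

    role-inner : ∀ {v} → v ≢ A → v ≢ next A → next v ≢ A → role v ≡ inner
    role-inner {v} v≢A v≢A⁺ v⁺≢A
      rewrite dec-false (v ≟ A) v≢A | dec-false (v ≟ next A) v≢A⁺ | dec-false (next v ≟ A) v⁺≢A = refl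

    act : Role → Colour → Colour → Colour
    act apex  l r = if does (hit? l r) then a else b
    act first l r = if does (l ≟ b) then c₂ else cobit r
    act last  l r = if does (r ≟ b) then c₀ else rotate l
    act inner l r = innerGuess l r

    strategy : Strategy G
    strategy v see = act (role v) (see (left v)) (see (right v))

    module _ (no-early-return : ∀ k → 0 < k → k < 3 + d → fold A next k ≢ A) where

      private
        w : ℕ → Fin m
        w = fold A next

        w≢A⁺ : ∀ k → 0 < k → k < 2 + d → w (suc k) ≢ next A
        w≢A⁺ k 0<k k<2+d e = no-early-return k 0<k (m<n⇒m<1+n k<2+d)
          (trans (sym (prev-next (w k))) (trans (cong prev e) (prev-next A)))

      module Losing (C : Placement m) (wrong : ∀ v → strategy v (view G C v) ≢ C v) where

        misses-at : ∀ {k ρ} → role (w (suc k)) ≡ ρ → act ρ (C (w k)) (C (w (2 + k))) ≢ C (w (suc k))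
        misses-at {k} {ρ} e =
          subst (λ u → act ρ (C u) (C (w (2 + k))) ≢ C (w (suc k))) (prev-next (w k))
            (subst (λ ρ → act ρ (C (prev (w (suc k)))) (C (w (2 + k))) ≢ C (w (suc k))) e
              (wrong (w (suc k))))

        apex-misses : act apex (C (w (2 + d))) (C (w 1)) ≢ C A
        apex-misses = subst (λ ρ → act ρ (C (w (2 + d))) (C (w 1)) ≢ C A) role-apex (wrong A)

        first-misses : act first (C A) (C (w 2)) ≢ C (w 1)
        first-misses = misses-at {0} (role-first (no-early-return 1 (s≤s z≤n) (s≤s (s≤s z≤n))) refl)

        inner-misses : ∀ j → j < d → innerGuess (C (w (1 + j))) (C (w (3 + j))) ≢ C (w (2 + j))
        inner-misses j j<d = misses-at {suc j} (role-inner
          (no-early-return (2 + j) (s≤s z≤n) (s≤s (s≤s (s≤s (<⇒≤ j<d)))))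
          (w≢A⁺ (1 + j) (s≤s z≤n) (s≤s (m<n⇒m<1+n j<d)))
          (no-early-return (3 + j) (s≤s z≤n) (s≤s (s≤s (s≤s j<d)))))

        last-misses : act last (C (w (1 + d))) (C A) ≢ C (w (2 + d))
        last-misses = subst (λ u → act last (C (w (1 + d))) (C u) ≢ C (w (2 + d))) (period A)
          (misses-at {suc d} (role-last
            (no-early-return (2 + d) (s≤s z≤n) ≤-refl)
            (w≢A⁺ (1 + d) (s≤s z≤n) ≤-refl)
            (period A)))

        CA≢b : C A ≢ b
        CA≢b CA≡b
          with decidable-stable (hit? _ _) (λ ¬hit → apex-misses (trans (if-no (hit? _ _) ¬hit) (sym CA≡b)))
        ... | inj₁ p≡c₂ = first-misses (trans (if-yes (C A ≟ b) CA≡b) (sym p≡c₂))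
        ... | inj₂ q≡c₀ = last-misses (trans (if-yes (C A ≟ b) CA≡b) (sym q≡c₀))

        CA≢a : C A ≢ a
        CA≢a CA≡a = last-misses (begin
            act last (C (w (1 + d))) (C A)  ≡⟨ if-no (C A ≟ b) CA≢b ⟩
            rotate (C (w (1 + d)))          ≡⟨ cong rotate (chain d ≤-refl) ⟩
            rotate (bit (C (w (2 + d))))    ≡⟨ rotate-bit (λ q≡c₀ → ¬hit (inj₂ q≡c₀)) ⟩
            C (w (2 + d))                   ∎)
          where
          open ≡-Reasoning

          ¬hit : ¬ Hit (C (w (2 + d))) (C (w 1))
          ¬hit hit = apex-misses (trans (if-yes (hit? _ _) hit) (sym CA≡a))

          chain : ∀ j → j ≤ d → C (w (suc j)) ≡ bit (C (w (2 + j)))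
          chain zero _ = cobit-miss (C (w 2)) (λ p≡c₂ → ¬hit (inj₁ p≡c₂))
            (λ e → first-misses (trans (if-no (C A ≟ b) CA≢b) e))
          chain (suc j) j<d = innerGuess-miss (C (w (2 + j))) (C (w (3 + j)))
            (λ e → inner-misses j j<d
              (trans (cong (λ x → innerGuess x (C (w (3 + j)))) (chain j (<⇒≤ j<d))) e))

      wins : (C : Placement m) → C A ≡ a ⊎ C A ≡ b → SomeoneCorrect G strategy C
      wins C CA = decidable-stable (any? λ v → strategy v (view G C v) ≟ C v) λ none →
        let open Losing C (λ v e → none (v , e)) in [ CA≢a , CA≢b ] CA

[1+m%n]%n≡[1+m]%n : ∀ m n .{{_ : NonZero n}} → suc (m % n) % n ≡ suc m % n
[1+m%n]%n≡[1+m]%n m n = sym (begin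
  suc m % n                       ≡⟨ cong (λ x → suc x % n) (m≡m%n+[m/n]*n m n) ⟩
  (suc (m % n) + m / n * n) % n   ≡⟨ [m+kn]%n≡m%n (suc (m % n)) (m / n) n ⟩
  suc (m % n) % n                 ∎)
  where open ≡-Reasoning

[m+o]%n≢m : ∀ m {o n} .{{_ : NonZero n}} .{{_ : NonZero o}} → o < n → (m + o) % n ≢ m
[m+o]%n≢m m {o} {n} o<n eq = >⇒∤ o<n (divides ((m + o) / n) (+-cancelˡ-≡ m o _ (begin
  m + o                        ≡⟨ m≡m%n+[m/n]*n (m + o) n ⟩
  (m + o) % n + (m + o) / n * n ≡⟨ cong (_+ (m + o) / n * n) eq ⟩
  m + (m + o) / n * n          ∎)))
  where open ≡-Reasoning

module _ (n : ℕ) where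

  cycle-next : Fin (suc n) → Fin (suc n)
  cycle-next v = suc (toℕ v) mod suc n

  toℕ-cycle-next : ∀ v → toℕ (cycle-next v) ≡ suc (toℕ v) % suc n
  toℕ-cycle-next v = toℕ-fromℕ< _

  toℕ-fold-cycle-next : ∀ v k → toℕ (fold v cycle-next k) ≡ (toℕ v + k) % suc n
  toℕ-fold-cycle-next v zero =
    sym (trans (cong (_% suc n) (+-identityʳ (toℕ v))) (m<n⇒m%n≡m (toℕ<n v)))
  toℕ-fold-cycle-next v (suc k) = begin
    toℕ (cycle-next (fold v cycle-next k))   ≡⟨ toℕ-cycle-next (fold v cycle-next k) ⟩
    suc (toℕ (fold v cycle-next k)) % suc n  ≡⟨ cong (λ x → suc x % suc n) (toℕ-fold-cycle-next v k) ⟩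
    suc ((toℕ v + k) % suc n) % suc n        ≡⟨ [1+m%n]%n≡[1+m]%n (toℕ v + k) (suc n) ⟩
    suc (toℕ v + k) % suc n                  ≡⟨ cong (_% suc n) (+-suc (toℕ v) k) ⟨
    (toℕ v + suc k) % suc n                  ∎
    where open ≡-Reasoning

  cycle-next-period : ∀ v → fold v cycle-next (suc n) ≡ v
  cycle-next-period v = toℕ-injective (begin
    toℕ (fold v cycle-next (suc n))  ≡⟨ toℕ-fold-cycle-next v (suc n) ⟩
    (toℕ v + suc n) % suc n          ≡⟨ [m+n]%n≡m%n (toℕ v) (suc n) ⟩
    toℕ v % suc n                    ≡⟨ m<n⇒m%n≡m (toℕ<n v) ⟩
    toℕ v                            ∎)
    where open ≡-Reasoning

  cycle-next-no-early-return : ∀ v k → 0 < k → k < suc n → fold v cycle-next k ≢ v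
  cycle-next-no-early-return v (suc k) _ k<n e =
    [m+o]%n≢m (toℕ v) k<n (trans (sym (toℕ-fold-cycle-next v (suc k))) (cong toℕ e))

lemma9 : (n : ℕ) → 3 ≤ suc n → (A : Fin (suc n)) → WinsWithHintA-1 (Cycle n) A
lemma9 0 (s≤s ())
lemma9 1 (s≤s (s≤s ()))
lemma9 (suc (suc d)) _ A i =
  strategy A a b , λ C CA≢i →
    wins A a b (cycle-next-no-early-return (2 + d) A) C (≢⇒rotate⊎rotate² CA≢i)
  where
  a b : Colour
  a = rotate i
  b = rotate (rotate i)
  open CycleStrategy (Cycle (2 + d)) (cycle-next (2 + d)) d
    (λ v → inj₁ (toℕ-cycle-next (2 + d) v)) (λ v → inj₂ (toℕ-cycle-next (2 + d) v))
    (cycle-next-period (2 + d))
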